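{- Let $\Lambda$ be the cross section lattice of a $J$-irreducible monoid, with $\phi$, $J_0$, $\Delta$ as in the context. Let $e,f\in\Lambda$, $U=\phi(e)$, $V=\phi(f)$. Then: (1) $\alpha\in\phi(e\wedge f)$ if and only if $\alpha\in U\cap V$ and $J_0$ does not contain the connected component of $U\cap V$ containing $\alpha$; (2) if $V\cap J_0=\emptyset$, then $\phi(e\wedge f)=U\cap V$; (3) if $V\cap J_0=\emptyset$, then for every subset $Y\subseteq V$ there exists $h\in\Lambda$ with $h\le f$ and $\phi(h)=Y$.
   Context: Let $K$ be an algebraically closed field, $G_0$ a semisimple linear algebraic group over $K$, $\rho:G_0\to GL(V)$ an irreducible rational representation, $G=K^*\cdot\rho(G_0)$, $M=\overline{G}\subseteq\mathrm{End}(V)$ its Zariski closure (a $J$-irreducible monoid). A cross section lattice is a finite set $\Lambda$ of idempotents of $M$ meeting every $G\times G$-orbit in exactly one element, ordered by $e\le f\iff e=ef=fe$; it is a lattice with least element $0$ and unique minimal nonzero element $e_0$. Let $T=C_G(\Lambda)$, $B=\{g\in G:ge=ege\ \forall e\in\Lambda\}$, $\Delta$ the simple roots of $T$ relative to $B$, $\sigma_\alpha$ the simple reflections in $W=N_G(T)/T$, $\phi(e)=\{\alpha\in\Delta:\sigma_\alpha e=e\sigma_\alpha\ne e\}$, $J_0=\{\alpha\in\Delta:\sigma_\alpha e_0=e_0\sigma_\alpha\}$. Connectedness refers to the Coxeter diagram: $\alpha\ne\beta$ adjacent iff $\sigma_\alpha\sigma_\beta\ne\sigma_\beta\sigma_\alpha$;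 connected components of a subset are its maximal connected subsets. By Putcha–Renner, $\phi$ restricted to $\Lambda\setminus\{0\}$ is an order isomorphism onto the family of $I\subseteq\Delta$ (ordered by inclusion) no connected component of which lies entirely in $J_0$. -}

module Defs where

open import Level using (Level; _⊔_; suc; 0ℓ)
open import Data.Nat using (ℕ)
open import Data.Fin using (Fin)
open import Data.Fin.Subset using (Subset; _∈_; _⊆_) renaming (⊥ to ∅)
open import Data.Product using (Σ; _×_)
open import Relation.Nullary using (¬_)
open import Relation.Binary.PropositionalEquality using (_≡_)
open import Relation.Binary.Lattice.Bundles using (Lattice)

-- The Coxeter diagram on the set of simple roots Δ = Fin n:
-- α ∼ β  iff  σ_α σ_β ≠ σ_β σ_α  (an irreflexive symmetric relation).
record CoxeterDiagram (n : ℕ) : Set₁ where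
  field
    _∼_    : Fin n → Fin n → Set
    irrefl : ∀ {α} → ¬ (α ∼ α)
    sym    : ∀ {α β} → α ∼ β → β ∼ α

module _ {n : ℕ} (D : CoxeterDiagram n) where
  open CoxeterDiagram D

  data Reach (S : Subset n) (α : Fin n) : Fin n → Set where
    here : α ∈ S → Reach S α α
    step : ∀ {β γ} → Reach S α β → γ ∈ S → β ∼ γ → Reach S α γ

  ComponentIn : Subset n → Subset n → Fin n → Set
  ComponentIn J S α = ∀ β → Reach S α β → β ∈ J

  Admissible : Subset n → Subset n → Set
  Admissible J₀ I = ∀ α → α ∈ I → ¬ ComponentIn J₀ I α

-- The data of a cross section lattice Λ (with least element 0) together
-- with φ : Λ → P(Δ), satisfying φ(0) = ∅ (immediate from the definition of φ,
-- since σ·0 = 0·σ = 0) and the Putcha–Renner theorem: φ restricted to Λ∖{0}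
-- is an order isomorphism onto the admissible subsets of Δ.
record CrossSectionData {c ℓ₁ ℓ₂ : Level} (Λ : Lattice c ℓ₁ ℓ₂) {n : ℕ}
         (D : CoxeterDiagram n) (J₀ : Subset n) : Set (suc (c ⊔ ℓ₁ ⊔ ℓ₂)) where
  open Lattice Λ
  field
    zero      : Carrier
    zero-least : ∀ e → zero ≤ e
    φ         : Carrier → Subset n
    φ-resp    : ∀ {e f} → e ≈ f → φ e ≡ φ f
    φ-zero    : φ zero ≡ ∅
    φ-mono    : ∀ {e f} → ¬ (e ≈ zero) → ¬ (f ≈ zero) → e ≤ f → φ e ⊆ φ f
    φ-reflect : ∀ {e f} → ¬ (e ≈ zero) → ¬ (f ≈ zero) → φ e ⊆ φ f → e ≤ f
    φ-into    : ∀ {e} → ¬ (e ≈ zero) → Admissible D J₀ (φ e)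
    φ-onto    : ∀ {I} → Admissible D J₀ I → Σ Carrier (λ e → ¬ (e ≈ zero) × φ e ≡ I)

-- φ (e ∧ f) lies in U ∩ V by monotonicity and is admissible; since a component
-- of a subset of U ∩ V lies inside a component of U ∩ V, no point of φ (e ∧ f)
-- has its component of U ∩ V inside J₀. Conversely, the points of U ∩ V whose
-- component is not inside J₀ form an admissible set A = φ h; reflection gives
-- h ≤ e and h ≤ f, so A ⊆ φ (e ∧ f). If V misses J₀ every point of U ∩ V
-- qualifies, which is (2), and (3) follows from (2) applied to g ∧ f with φ g = Y.
module Submission where

open import Defs
open import Level using (Level)
open import Data.Nat using (ℕ; zero; suc)
open import Data.Fin using (Fin; zero; suc)
open import Data.Fin.Subset using (Subset; _∈_; _∉_; _⊆_; _∩_; Empty; inside; outside) renaming (⊥ to ∅)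
open import Data.Fin.Subset.Properties using (_∈?_; ⊆-antisym; p∩q⊆p; x∈p∩q⁺; x∈p∩q⁻; ∉⊥; drop-there)
open import Data.Vec.Base using ([]; _∷_; here; there)
open import Data.Product using (Σ; _×_; _,_; proj₁; proj₂)
open import Data.Empty using (⊥-elim)
open import Function using (_∘_; const)
open import Function.Bundles using (_⇔_; mk⇔; Equivalence)
open import Relation.Nullary using (¬_; Dec; yes; no)
open import Relation.Nullary.Decidable using (decidable-stable; ¬¬-excluded-middle)
open import Relation.Binary.PropositionalEquality using (_≡_; subst; sym; trans; cong)
open import Relation.Binary.Lattice.Bundles using (Lattice)

open Equivalence using (to; from)

¬¬-decide-all : ∀ {n} (P : Fin n → Set) → ¬ ¬ (∀ α → Dec (P α))
¬¬-decide-all {zero}  P k = k (λ ())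
¬¬-decide-all {suc n} P k =
  ¬¬-excluded-middle λ d₀ → ¬¬-decide-all (P ∘ suc) λ ds →
  k λ { zero → d₀ ; (suc α) → ds α }

comprehension : ∀ {n} {P : Fin n → Set} → (∀ α → Dec (P α)) →
                Σ (Subset n) λ A → ∀ α → α ∈ A ⇔ P α
comprehension {zero}  d = [] , λ ()
comprehension {suc n} d with comprehension (d ∘ suc) | d zero
... | A , A⇔ | yes p = inside ∷ A , λ
  { zero    → mk⇔ (const p) (const here)
  ; (suc α) → mk⇔ (to (A⇔ α) ∘ drop-there) (there ∘ from (A⇔ α)) }
... | A , A⇔ | no ¬p = outside ∷ A , λ
  { zero    → mk⇔ (λ ()) (⊥-elim ∘ ¬p)
  ; (suc α) → mk⇔ (to (A⇔ α) ∘ drop-there) (there ∘ from (A⇔ α)) }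

¬¬-comprehension : ∀ {n} (P : Fin n → Set) → ¬ ¬ (Σ (Subset n) λ A → ∀ α → α ∈ A ⇔ P α)
¬¬-comprehension P k = ¬¬-decide-all P (k ∘ comprehension)

∩-disjoint⇒∉ : ∀ {n} {p q : Subset n} {α} → Empty (p ∩ q) → α ∈ p → α ∉ q
∩-disjoint⇒∉ p∩q=∅ α∈p α∈q = p∩q=∅ (_ , x∈p∩q⁺ (α∈p , α∈q))

⊆⇒∩≡ : ∀ {n} {p q : Subset n} → p ⊆ q → p ∩ q ≡ p
⊆⇒∩≡ {p = p} {q} p⊆q = ⊆-antisym (p∩q⊆p p q) (λ α∈p → x∈p∩q⁺ (α∈p , p⊆q α∈p))

module _ {n : ℕ} (D : CoxeterDiagram n) where
  open CoxeterDiagram D using () renaming (sym to ∼-sym)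

  private variable
    α β γ : Fin n
    S I J : Subset n

  Reach-∈ : Reach D S α β → β ∈ S
  Reach-∈ (here α∈S)     = α∈S
  Reach-∈ (step _ β∈S _) = β∈S

  Reach-trans : Reach D S α β → Reach D S β γ → Reach D S α γ
  Reach-trans r (here _)       = r
  Reach-trans r (step r′ γ∈S s) = step (Reach-trans r r′) γ∈S s

  Reach-sym : Reach D S α β → Reach D S β α
  Reach-sym (here α∈S)      = here α∈S
  Reach-sym (step r γ∈S s) = Reach-trans (step (here γ∈S) (Reach-∈ r) (∼-sym s)) (Reach-sym r)

  Reach-restrict : (∀ {β} → Reach D S α β → β ∈ I) → Reach D S α β → Reach D I α β
  Reach-restrict closed (here α∈S)      = here (closed (here α∈S))
  Reach-restrict closed (step r γ∈S s) = step (Reach-restrict closed r) (closed (step r γ∈S s)) s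

  ComponentIn-antitone : I ⊆ S → ComponentIn D J S α → ComponentIn D J I α
  ComponentIn-antitone I⊆S C β r = C β (Reach-restrict (I⊆S ∘ Reach-∈) r)

  Essential : Subset n → Subset n → Fin n → Set
  Essential J S α = α ∈ S × ¬ ComponentIn D J S α

  Essential-∉ : α ∈ S → α ∉ J → Essential J S α
  Essential-∉ α∈S α∉J = α∈S , λ C → α∉J (C _ (here α∈S))

  Essential-Reach : Essential J S α → Reach D S α β → Essential J S β
  Essential-Reach (_ , ¬C) r = Reach-∈ r , λ C → ¬C λ γ r′ → C γ (Reach-trans (Reach-sym r) r′)

  -- The essential part of S is a union of connected components of S.
  Essential-admissible : {A : Subset n} → (∀ α → α ∈ A ⇔ Essential J S α) → Admissible D J A
  Essential-admissible {J} {S} {A} A⇔ α α∈A C = proj₂ essential λ β r → C β (Reach-restrict inA r)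
    where
    essential : Essential J S α
    essential = to (A⇔ α) α∈A
    inA : ∀ {β} → Reach D S α β → β ∈ A
    inA r = from (A⇔ _) (Essential-Reach essential r)

  Admissible-disjoint : (∀ {α} → α ∈ I → α ∉ J) → Admissible D J I
  Admissible-disjoint disjoint α α∈I = proj₂ (Essential-∉ α∈I (disjoint α∈I))

module _ {c ℓ₁ ℓ₂ : Level} {Λ : Lattice c ℓ₁ ℓ₂} {n : ℕ} {D : CoxeterDiagram n} {J₀ : Subset n}
         (X : CrossSectionData Λ D J₀) where
  open Lattice Λ hiding (trans)
  open CrossSectionData X renaming (zero to 𝟎)

  private variable
    e f : Carrier
    α : Fin n

  φ-≈𝟎 : e ≈ 𝟎 → φ e ≡ ∅
  φ-≈𝟎 e≈𝟎 = trans (φ-resp e≈𝟎) φ-zero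

  ∈φ⇒≉𝟎 : α ∈ φ e → ¬ e ≈ 𝟎
  ∈φ⇒≉𝟎 α∈φe e≈𝟎 = ∉⊥ (subst (_ ∈_) (φ-≈𝟎 e≈𝟎) α∈φe)

  ≉𝟎-mono : e ≤ f → ¬ e ≈ 𝟎 → ¬ f ≈ 𝟎
  ≉𝟎-mono e≤f e≉𝟎 f≈𝟎 = e≉𝟎 (antisym (≤-respʳ-≈ f≈𝟎 e≤f) (zero-least _))

  φ-∧⊆∩ : φ (e ∧ f) ⊆ φ e ∩ φ f
  φ-∧⊆∩ {e} {f} α∈φm = x∈p∩q⁺ (φ-mono m≉𝟎 (≉𝟎-mono (x∧y≤x e f) m≉𝟎) (x∧y≤x e f) α∈φm ,
                                φ-mono m≉𝟎 (≉𝟎-mono (x∧y≤y e f) m≉𝟎) (x∧y≤y e f) α∈φm)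
    where
    m≉𝟎 : ¬ (e ∧ f) ≈ 𝟎
    m≉𝟎 = ∈φ⇒≉𝟎 α∈φm

  φ-∧⇒Essential : α ∈ φ (e ∧ f) → Essential D J₀ (φ e ∩ φ f) α
  φ-∧⇒Essential α∈φm = φ-∧⊆∩ α∈φm ,
    λ C → φ-into (∈φ⇒≉𝟎 α∈φm) _ α∈φm (ComponentIn-antitone D φ-∧⊆∩ C)

  -- Realise the essential part A of φ e ∩ φ f as φ h; then h ≤ e ∧ f.
  -- A exists only under ¬¬, which is harmless as membership is decidable.
  Essential⇒φ-∧ : Essential D J₀ (φ e ∩ φ f) α → α ∈ φ (e ∧ f)
  Essential⇒φ-∧ {e} {f} {α} essential = decidable-stable (α ∈? φ (e ∧ f)) λ α∉φm →
    ¬¬-comprehension (Essential D J₀ (φ e ∩ φ f)) λ { (A , A⇔) → α∉φm (viaA A A⇔) }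
    where
    S⊆e : φ e ∩ φ f ⊆ φ e
    S⊆e = proj₁ ∘ x∈p∩q⁻ (φ e) (φ f)
    S⊆f : φ e ∩ φ f ⊆ φ f
    S⊆f = proj₂ ∘ x∈p∩q⁻ (φ e) (φ f)
    viaA : ∀ A → (∀ β → β ∈ A ⇔ Essential D J₀ (φ e ∩ φ f) β) → α ∈ φ (e ∧ f)
    viaA A A⇔ with φ-onto (Essential-admissible D A⇔)
    ... | h , h≉𝟎 , φh≡A = φ-mono h≉𝟎 (≉𝟎-mono h≤m h≉𝟎) h≤m α∈φh
      where
      e≉𝟎 : ¬ e ≈ 𝟎
      e≉𝟎 = ∈φ⇒≉𝟎 (S⊆e (proj₁ essential))
      f≉𝟎 : ¬ f ≈ 𝟎
      f≉𝟎 = ∈φ⇒≉𝟎 (S⊆f (proj₁ essential))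
      φh⊆S : φ h ⊆ φ e ∩ φ f
      φh⊆S β∈φh = proj₁ (to (A⇔ _) (subst (_ ∈_) φh≡A β∈φh))
      h≤m : h ≤ e ∧ f
      h≤m = ∧-greatest (φ-reflect h≉𝟎 e≉𝟎 (S⊆e ∘ φh⊆S)) (φ-reflect h≉𝟎 f≉𝟎 (S⊆f ∘ φh⊆S))
      α∈φh : α ∈ φ h
      α∈φh = subst (α ∈_) (sym φh≡A) (from (A⇔ α) essential)

  φ-∧-disjoint : Empty (φ f ∩ J₀) → φ (e ∧ f) ≡ φ e ∩ φ f
  φ-∧-disjoint {f} {e} V∩J₀=∅ = ⊆-antisym φ-∧⊆∩ λ α∈S →
    Essential⇒φ-∧ (Essential-∉ D α∈S (∩-disjoint⇒∉ V∩J₀=∅ (proj₂ (x∈p∩q⁻ (φ e) (φ f) α∈S))))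

  φ-below-onto : Empty (φ f ∩ J₀) → ∀ Y → Y ⊆ φ f → Σ Carrier λ h → h ≤ f × φ h ≡ Y
  φ-below-onto {f} V∩J₀=∅ Y Y⊆V with φ-onto (Admissible-disjoint D (∩-disjoint⇒∉ V∩J₀=∅ ∘ Y⊆V))
  ... | g , _ , φg≡Y = g ∧ f , x∧y≤y g f ,
    trans (φ-∧-disjoint V∩J₀=∅) (trans (cong (_∩ φ f) φg≡Y) (⊆⇒∩≡ Y⊆V))

mainTheorem5 : ∀ {c ℓ₁ ℓ₂ : Level} (Λ : Lattice c ℓ₁ ℓ₂) {n : ℕ}
    (D : CoxeterDiagram n) (J₀ : Subset n) (X : CrossSectionData Λ D J₀) →
    ∀ (e f : Lattice.Carrier Λ) →
    ((∀ (α : Fin n) →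
        (α ∈ CrossSectionData.φ X (Lattice._∧_ Λ e f) →
           (α ∈ (CrossSectionData.φ X e ∩ CrossSectionData.φ X f))
           × ¬ ComponentIn D J₀ (CrossSectionData.φ X e ∩ CrossSectionData.φ X f) α)
        × ((α ∈ (CrossSectionData.φ X e ∩ CrossSectionData.φ X f))
           × ¬ ComponentIn D J₀ (CrossSectionData.φ X e ∩ CrossSectionData.φ X f) α →
           α ∈ CrossSectionData.φ X (Lattice._∧_ Λ e f)))
     × (Empty (CrossSectionData.φ X f ∩ J₀) →
         CrossSectionData.φ X (Lattice._∧_ Λ e f) ≡ CrossSectionData.φ X e ∩ CrossSectionData.φ X f)
     × (Empty (CrossSectionData.φ X f ∩ J₀) →
         ∀ (Y : Subset n) → Y ⊆ CrossSectionData.φ X f →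
         Σ (Lattice.Carrier Λ) (λ h → Lattice._≤_ Λ h f × CrossSectionData.φ X h ≡ Y)))
mainTheorem5 Λ D J₀ X e f =
  (λ α → φ-∧⇒Essential X , Essential⇒φ-∧ X) ,
  φ-∧-disjoint X ,
  φ-below-onto X
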